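{- Let $s(N),t(N)$ be non-decreasing functions. Any $(s(N),t(N))$-implementation of resizable arrays must satisfy $s(N)\,t(N)\ge N$ (for every $N$), and this holds even if only grow and access operations are performed.
   Context: A resizable array stores a sequence $a_0,\dots,a_{N-1}$ ($N$ is its current size) and supports: creating an empty array, returning its length, reading or overwriting the $i$-th item ($0\le i<N$), Grow$(a)$ which appends a new last item $a$, and Shrink() which removes the last item. An implementation keeps its data in dynamically allocated fixed-length contiguous blocks of memory words (blocks may be allocated and deallocated at any time); each item occupies one word and each pointer occupies one word; every block other than a single main index block must be pointed to by a pointer stored in some block (otherwise it would be inaccessible). The space used at any moment is the total length of all currently allocated blocks. For non-decreasing functions $s,t$, an $(s(N),t(N))$-implementation is one that uses at most $N+s(N)$ space to store an array of size $N$, and at most $N+t(N)$ space at any moment during a grow or shrink operation on an array of size $N$. -}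

module Defs where

open import Data.Nat using (ℕ; zero; suc; _+_; _*_; _≤_; _≟_)
open import Data.Bool using (Bool; true; false; if_then_else_)
open import Data.List using (List; []; _∷_; _++_; replicate; length; map; lookup)
open import Data.Nat.ListAction using (sum)
open import Data.List.Membership.Propositional using (_∈_)
open import Data.List.Relation.Unary.Any using (Any)
open import Data.List.Relation.Unary.All using (All)
open import Data.Maybe using (Maybe; just; nothing; _>>=_)
import Data.Maybe as Maybe
open import Data.Product using (_×_; _,_; Σ; ∃; proj₁; proj₂)
open import Data.Fin using (Fin)
open import Relation.Nullary using (yes; no; ¬_)
open import Relation.Binary.PropositionalEquality using (_≡_; _≢_)

-- A memory word is empty (never written / erased), holds an item
-- (items are natural numbers), or holds a pointer to a block (by id).
data Word : Set where
  empty : Word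
  item  : ℕ → Word
  ptr   : ℕ → Word

-- A block: its identifier and its (fixed-length) contents.
Block : Set
Block = ℕ × List Word

Mem : Set
Mem = List Block

mainId : ℕ
mainId = 0

space : Mem → ℕ
space m = sum (map (λ b → length (proj₂ b)) m)

record Loc : Set where
  constructor _at_
  field
    blk : ℕ
    off : ℕ

readList : List Word → ℕ → Maybe Word
readList []       _       = nothing
readList (w ∷ ws) zero    = just w
readList (w ∷ ws) (suc i) = readList ws i

writeList : List Word → ℕ → Word → Maybe (List Word)
writeList []       _       _ = nothing
writeList (w ∷ ws) zero    v = just (v ∷ ws)
writeList (w ∷ ws) (suc i) v = Maybe.map (w ∷_) (writeList ws i v)

readMem : Mem → Loc → Maybe Word
readMem []             _        = nothing
readMem ((b , ws) ∷ m) (c at i) with b ≟ c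
... | yes _ = readList ws i
... | no  _ = readMem m (c at i)

writeMem : Mem → Loc → Word → Maybe Mem
writeMem []             _        _ = nothing
writeMem ((b , ws) ∷ m) (c at i) v with b ≟ c
... | yes _ = Maybe.map (λ ws′ → (b , ws′) ∷ m) (writeList ws i v)
... | no  _ = Maybe.map ((b , ws) ∷_) (writeMem m (c at i) v)

isAllocated : Mem → ℕ → Bool
isAllocated []             c = false
isAllocated ((b , _) ∷ m) c with b ≟ c
... | yes _ = true
... | no  _ = isAllocated m c

removeBlock : Mem → ℕ → Mem
removeBlock []             c = []
removeBlock ((b , ws) ∷ m) c with b ≟ c
... | yes _ = m
... | no  _ = (b , ws) ∷ removeBlock m c

data Step : Set where
  alloc  : (b len : ℕ) → Step
  free   : ℕ → Step
  copy   : (src dst : Loc) → Step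
  putNew : Loc → Step           -- write the new item (argument of Grow)
  putPtr : Loc → ℕ → Step
  erase  : Loc → Step

-- Executing one step; x is the new item of the current Grow.
-- nothing = invalid step.
step : ℕ → Mem → Step → Maybe Mem
step x m (alloc b len) =
  if isAllocated m b then nothing else just (m ++ (b , replicate len empty) ∷ [])
step x m (free b) with b ≟ mainId
... | yes _ = nothing
... | no  _ = if isAllocated m b then just (removeBlock m b) else nothing
step x m (copy src dst) = readMem m src >>= λ w → writeMem m dst w
step x m (putNew l)     = writeMem m l (item x)
step x m (putPtr l b)   = writeMem m l (ptr b)
step x m (erase l)      = writeMem m l empty

-- All memory states after each step (initial state excluded).
exec : ℕ → Mem → List Step → Maybe (List Mem)
exec x m []       = just []
exec x m (s ∷ ss) = step x m s >>= λ m′ → Maybe.map (m′ ∷_) (exec x m′ ss)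

final : Mem → List Mem → Mem
final m []        = m
final m (m′ ∷ ms) = final m′ ms

record Impl : Set where
  field
    -- length of the main index block (allocated on creation, never freed)
    mainLen   : ℕ
    -- steps of Grow(x) given current contents and memory
    growSteps : List ℕ → ℕ → Mem → List Step
    -- access: location of the i-th item
    access    : List ℕ → Mem → ℕ → Loc

open Impl public

initMem : Impl → Mem
initMem I = (mainId , replicate (mainLen I) empty) ∷ []

-- Reached I as m : after creating an empty array and performing
-- Grow(a_0), ..., Grow(a_{N-1}), the array holds as and memory is m.
data Reached (I : Impl) : List ℕ → Mem → Set where
  init : Reached I [] (initMem I)
  grow : ∀ {as m x ms} → Reached I as m →
         exec x m (growSteps I as x m) ≡ just ms →
         Reached I (as ++ x ∷ []) (final m ms)

Allocated : Mem → ℕ → Set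
Allocated m b = Any (λ blk → proj₁ blk ≡ b) m

PointedTo : Mem → ℕ → Set
PointedTo m b = ∃ λ blk → blk ∈ m × ptr b ∈ proj₂ blk

record Correct (I : Impl) : Set where
  field
    growValid : ∀ {as m} → Reached I as m → ∀ x →
                ∃ λ ms → exec x m (growSteps I as x m) ≡ just ms
    accessOK  : ∀ {as m} → Reached I as m → (i : Fin (length as)) →
                readMem m (access I as m (Data.Fin.toℕ i)) ≡ just (item (lookup as i))
    pointers  : ∀ {as m} → Reached I as m → ∀ b → b ≢ mainId →
                Allocated m b → PointedTo m b

record IsST (s t : ℕ → ℕ) (I : Impl) : Set where
  field
    storeBound : ∀ {as m} → Reached I as m → space m ≤ length as + s (length as)
    growBound  : ∀ {as m} → Reached I as m → ∀ x ms →
                 exec x m (growSteps I as x m) ≡ just ms →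
                 All (λ m′ → space m′ ≤ length as + t (length as)) (m ∷ ms)

NonDecreasing : (ℕ → ℕ) → Set
NonDecreasing f = ∀ {m n} → m ≤ n → f m ≤ f n

-- Grow the array with the distinct items 0, 1, …, N − 1. No step creates an item
-- other than the one being appended, so while the size goes from n to n + 1 the
-- memory holds n distinct items; a block allocated then therefore has length at
-- most t(n) ≤ t(N), and t(n) ≥ 1 since the new item needs room too. At the end
-- each of the k non-main blocks is the target of a distinct pointer, so
-- N + k ≤ space ≤ N + s(N) and k ≤ s(N), while the main block is as long as in
-- the empty array, at most s(0) ≤ s(N). Hence N + k ≤ s(N) + k t(N), i.e.
-- N ≤ s(N) + k (t(N) − 1) ≤ s(N) t(N).

module Submission where

open import Defs
open import Data.Nat using (ℕ; zero; suc; _+_; _*_; _≤_; z≤n; s≤s)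
open import Data.Nat.Properties
open import Data.Nat.ListAction using (sum)
open import Data.Nat.ListAction.Properties using (sum-++)
open import Data.Bool using (true; false)
open import Data.List using (List; []; _∷_; _++_; _∷ʳ_; [_]; replicate; length; map; concat; upTo)
open import Data.List.Properties
  using (length-++; length-replicate; length-map; map-++; ++-assoc; ++-identityʳ; length-upTo; upTo-∷ʳ)
open import Data.List.Membership.Propositional using (_∈_; _∉_)
open import Data.List.Membership.Propositional.Properties
  using (∈-++⁺ˡ; ∈-++⁺ʳ; ∈-++⁻; ∈-map⁺; ∈-map⁻; ∈-concat⁺′; ∈-concat⁻′)
open import Data.List.Relation.Binary.Subset.Propositional using (_⊆_)
import Data.List.Relation.Binary.Sublist.Propositional as Sublist
import Data.List.Relation.Binary.Sublist.Propositional.Properties as Sublist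
open import Data.List.Relation.Binary.Disjoint.Propositional using (Disjoint)
open import Data.List.Relation.Unary.Any using (here; there; index; _─_)
import Data.List.Relation.Unary.Any as Any
open import Data.List.Relation.Unary.Any.Properties using (lookup-index)
import Data.List.Relation.Unary.Any.Properties as Any
open import Data.List.Relation.Unary.All using (All; []; _∷_)
import Data.List.Relation.Unary.All as All
import Data.List.Relation.Unary.All.Properties as All
open import Data.List.Relation.Unary.AllPairs using ([]; _∷_)
open import Data.List.Relation.Unary.Unique.Propositional using (Unique)
import Data.List.Relation.Unary.Unique.Propositional.Properties as Unique
open import Data.Maybe using (just)
open import Data.Product using (∃; _×_; _,_; proj₁; proj₂; map₂)
open import Data.Sum using (_⊎_; inj₁; inj₂)
import Data.Sum as Sum
open import Data.Empty using (⊥-elim)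
open import Function using (_∘_)
open import Relation.Nullary using (yes; no; ¬_)
open import Relation.Binary.PropositionalEquality hiding ([_])

length-─ : ∀ {A : Set} {x : A} {xs} (x∈xs : x ∈ xs) → length xs ≡ suc (length (xs ─ x∈xs))
length-─ (here _)     = refl
length-─ (there x∈xs) = cong suc (length-─ x∈xs)

∈-─⁺ : ∀ {A : Set} {x y : A} {xs} (x∈xs : x ∈ xs) → y ∈ xs → x ≢ y → y ∈ (xs ─ x∈xs)
∈-─⁺ (here x≡z)   (here y≡z)   x≢y = ⊥-elim (x≢y (trans x≡z (sym y≡z)))
∈-─⁺ (here _)     (there y∈xs) _   = y∈xs
∈-─⁺ (there _)    (here y≡z)   _   = here y≡z
∈-─⁺ (there x∈xs) (there y∈xs) x≢y = there (∈-─⁺ x∈xs y∈xs x≢y)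

Unique-⊆⇒length≤ : ∀ {A : Set} {xs ys : List A} → Unique xs → xs ⊆ ys → length xs ≤ length ys
Unique-⊆⇒length≤ []            _     = z≤n
Unique-⊆⇒length≤ (x∉xs ∷ xs!) xs⊆ys =
  subst (_ ≤_) (sym (length-─ x∈ys))
    (s≤s (Unique-⊆⇒length≤ xs! λ y∈xs →
      ∈-─⁺ x∈ys (xs⊆ys (there y∈xs)) (All.lookup x∉xs y∈xs)))
  where
  x∈ys = xs⊆ys (here refl)

Unique-resp-⊆ : ∀ {A : Set} {xs ys : List A} → xs Sublist.⊆ ys → Unique ys → Unique xs
Unique-resp-⊆ Sublist.[]        []           = []
Unique-resp-⊆ (_ Sublist.∷ʳ τ)  (_ ∷ ys!)    = Unique-resp-⊆ τ ys!
Unique-resp-⊆ (refl Sublist.∷ τ) (y∉ys ∷ ys!) = Sublist.All-resp-⊆ τ y∉ys ∷ Unique-resp-⊆ τ ys!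

Unique-∷ʳ⁻ : ∀ {A : Set} (xs : List A) {x} → Unique (xs ∷ʳ x) → Unique xs × x ∉ xs
Unique-∷ʳ⁻ []       _            = [] , λ ()
Unique-∷ʳ⁻ (y ∷ xs) (y∉xsx ∷ xsx!) with Unique-∷ʳ⁻ xs xsx!
... | xs! , x∉xs = All.++⁻ˡ xs y∉xsx ∷ xs! , λ where
  (here x≡y)   → All.head (All.++⁻ʳ xs y∉xsx) (sym x≡y)
  (there x∈xs) → x∉xs x∈xs

n+k≤s+k*t⇒n≤s*t : ∀ {n k s t} → n + k ≤ s + k * t → k ≤ s → 1 ≤ t → n ≤ s * t
n+k≤s+k*t⇒n≤s*t {n} {k} {s} {suc t} n+k≤s+k*t k≤s _ = begin
  n          ≤⟨ +-cancelʳ-≤ k n (s + k * t) (≤-trans n+k≤s+k*t (≤-reflexive s+k*[1+t]≡s+k*t+k)) ⟩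
  s + k * t  ≤⟨ +-monoʳ-≤ s (*-monoˡ-≤ t k≤s) ⟩
  s + s * t  ≡⟨ *-suc s t ⟨
  s * suc t  ∎
  where
  open ≤-Reasoning
  s+k*[1+t]≡s+k*t+k : s + k * suc t ≡ s + k * t + k
  s+k*[1+t]≡s+k*t+k = trans (cong (s +_) (trans (*-suc k t) (+-comm k (k * t)))) (sym (+-assoc s (k * t) k))

words : Mem → List Word
words m = concat (map proj₂ m)

space≡length-words : ∀ m → space m ≡ length (words m)
space≡length-words []             = refl
space≡length-words ((_ , ws) ∷ m) = trans (cong (length ws +_) (space≡length-words m)) (sym (length-++ ws))

space-++ : ∀ m m′ → space (m ++ m′) ≡ space m + space m′
space-++ m m′ = trans (cong sum (map-++ _ m m′)) (sum-++ (map _ m) (map _ m′))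

space≤length*T : ∀ {T} m → All (λ blk → length (proj₂ blk) ≤ T) m → space m ≤ length m * T
space≤length*T []      []       = z≤n
space≤length*T (_ ∷ m) (p ∷ ps) = +-mono-≤ p (space≤length*T m ps)

words-++ : ∀ m m′ → words (m ++ m′) ≡ words m ++ words m′
words-++ []             m′ = refl
words-++ ((_ , ws) ∷ m) m′ = trans (cong (ws ++_) (words-++ m m′)) (sym (++-assoc ws (words m) (words m′)))

words-mono : ∀ {m m′} → m Sublist.⊆ m′ → words m ⊆ words m′
words-mono {m} τ w∈m with ∈-concat⁻′ (map proj₂ m) w∈m
... | ws , w∈ws , ws∈m = ∈-concat⁺′ w∈ws (Sublist.Any-resp-⊆ (Sublist.map⁺ proj₂ τ) ws∈m)

item-injective : ∀ {u v} → item u ≡ item v → u ≡ v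
item-injective refl = refl

ptr-injective : ∀ {b c} → ptr b ≡ ptr c → b ≡ c
ptr-injective refl = refl

Stores : Mem → List ℕ → Set
Stores m vs = ∀ {v} → v ∈ vs → item v ∈ words m

items-fit : ∀ {m vs} → Unique vs → Stores m vs → length vs ≤ space m
items-fit {m} {vs} vs! stores = begin
  length vs            ≡⟨ length-map item vs ⟨
  length (map item vs) ≤⟨ Unique-⊆⇒length≤ (Unique.map⁺ item-injective vs!) items⊆words ⟩
  length (words m)     ≡⟨ space≡length-words m ⟨
  space m              ∎
  where
  open ≤-Reasoning
  items⊆words : map item vs ⊆ words m
  items⊆words w∈ with ∈-map⁻ item w∈
  ... | _ , v∈vs , refl = stores v∈vs

readList-∈ : ∀ ws i {w} → readList ws i ≡ just w → w ∈ ws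
readList-∈ (_ ∷ _)  zero    refl = here refl
readList-∈ (_ ∷ ws) (suc i) eq   = there (readList-∈ ws i eq)

readMem-∈ : ∀ m l {w} → readMem m l ≡ just w → w ∈ words m
readMem-∈ ((b , ws) ∷ m) (c at i) eq with b ≟ c
... | yes _ = ∈-++⁺ˡ (readList-∈ ws i eq)
... | no  _ = ∈-++⁺ʳ ws (readMem-∈ m (c at i) eq)

writeList-length : ∀ ws i {v ws′} → writeList ws i v ≡ just ws′ → length ws′ ≡ length ws
writeList-length (_ ∷ _)  zero    refl = refl
writeList-length (_ ∷ ws) (suc i) {v} eq with writeList ws i v in eq′
... | just _ with refl ← eq = cong suc (writeList-length ws i eq′)

writeList-∈ : ∀ ws i {v ws′ w} → writeList ws i v ≡ just ws′ → w ∈ ws′ → w ∈ ws ⊎ w ≡ v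
writeList-∈ (_ ∷ _)  zero    refl (here w≡v)   = inj₂ w≡v
writeList-∈ (_ ∷ _)  zero    refl (there w∈ws) = inj₁ (there w∈ws)
writeList-∈ (_ ∷ ws) (suc i) {v} eq w∈ with writeList ws i v in eq′
... | just _ with refl ← eq with w∈
...   | here w≡u    = inj₁ (here w≡u)
...   | there w∈ws′ = Sum.map₁ there (writeList-∈ ws i eq′ w∈ws′)

writeMem-∈ : ∀ m l {v m′ w} → writeMem m l v ≡ just m′ → w ∈ words m′ → w ∈ words m ⊎ w ≡ v
writeMem-∈ ((b , ws) ∷ m) (c at i) {v} eq w∈ with b ≟ c
... | yes _ with writeList ws i v in eq′
...   | just ws′ with refl ← eq with ∈-++⁻ ws′ w∈
...     | inj₁ w∈ws′ = Sum.map₁ ∈-++⁺ˡ (writeList-∈ ws i eq′ w∈ws′)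
...     | inj₂ w∈m   = inj₁ (∈-++⁺ʳ ws w∈m)
writeMem-∈ ((b , ws) ∷ m) (c at i) {v} eq w∈ | no _ with writeMem m (c at i) v in eq′
...   | just m′ with refl ← eq with ∈-++⁻ ws w∈
...     | inj₁ w∈ws  = inj₁ (∈-++⁺ˡ w∈ws)
...     | inj₂ w∈m′  = Sum.map₁ (∈-++⁺ʳ ws) (writeMem-∈ m (c at i) eq′ w∈m′)

Layout : Set
Layout = List (ℕ × ℕ)

layout : Mem → Layout
layout = map (map₂ length)

writeMem-layout : ∀ m l {v m′} → writeMem m l v ≡ just m′ → layout m′ ≡ layout m
writeMem-layout ((b , ws) ∷ m) (c at i) {v} eq with b ≟ c
... | yes _ with writeList ws i v in eq′
...   | just _ with refl ← eq = cong (λ n → (b , n) ∷ layout m) (writeList-length ws i eq′)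
writeMem-layout ((b , ws) ∷ m) (c at i) {v} eq | no _ with writeMem m (c at i) v in eq′
...   | just _ with refl ← eq = cong ((b , length ws) ∷_) (writeMem-layout m (c at i) eq′)

∈-ids⇒Allocated : ∀ m {c} → c ∈ map proj₁ (layout m) → Allocated m c
∈-ids⇒Allocated m c∈ = Any.map sym (Any.map⁻ (Any.map⁻ c∈))

isAllocated-false⇒¬Allocated : ∀ m {b} → isAllocated m b ≡ false → ¬ Allocated m b
isAllocated-false⇒¬Allocated ((c , _) ∷ m) {b} eq allocated with c ≟ b | allocated
... | no c≢b | here c≡b       = c≢b c≡b
... | no _   | there allocated′ = isAllocated-false⇒¬Allocated m eq allocated′

removeBlock-⊆ : ∀ m b → removeBlock m b Sublist.⊆ m
removeBlock-⊆ []             b = Sublist.[]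
removeBlock-⊆ ((c , ws) ∷ m) b with c ≟ b
... | yes _ = (c , ws) Sublist.∷ʳ Sublist.⊆-refl
... | no  _ = refl Sublist.∷ removeBlock-⊆ m b

-- The main block stays at the head: it is allocated first, never freed, and
-- allocation appends.
data Bounded (L T : ℕ) : Layout → Set where
  bounded : ∀ {blocks} → All (λ blk → proj₂ blk ≤ T) blocks → Unique (mainId ∷ map proj₁ blocks) →
            Bounded L T ((mainId , L) ∷ blocks)

Bounded-init : ∀ L T → Bounded L T (layout ((mainId , replicate L empty) ∷ []))
Bounded-init L T =
  subst (λ n → Bounded L T ((mainId , n) ∷ [])) (sym (length-replicate L)) (bounded [] ([] ∷ []))

Bounded-∷ʳ : ∀ {L T lay b n} → b ∉ map proj₁ lay → n ≤ T → Bounded L T lay → Bounded L T (lay ∷ʳ (b , n))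
Bounded-∷ʳ {b = b} {n} b∉lay n≤T (bounded {blocks} small distinct) =
  bounded (All.++⁺ small (n≤T ∷ []))
    (subst (λ ids → Unique (mainId ∷ ids)) (sym (map-++ proj₁ blocks [ b , n ]))
      (Unique.++⁺ distinct ([] ∷ []) λ where (b∈lay , here refl) → b∉lay b∈lay))

Bounded-removeBlock : ∀ {L T} m {b} → b ≢ mainId →
                      Bounded L T (layout m) → Bounded L T (layout (removeBlock m b))
Bounded-removeBlock ((_ , ws) ∷ rest) {b} b≢main (bounded small distinct) with mainId ≟ b
... | yes main≡b = ⊥-elim (b≢main (sym main≡b))
... | no  _      =
  bounded (Sublist.All-resp-⊆ τ small) (Unique-resp-⊆ (refl Sublist.∷ Sublist.map⁺ proj₁ τ) distinct)
  where
  τ = Sublist.map⁺ (map₂ length) (removeBlock-⊆ rest b)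

Bounded⇒space≤ : ∀ {L T} blk rest → Bounded L T (layout (blk ∷ rest)) →
                 space (blk ∷ rest) ≤ L + length rest * T
Bounded⇒space≤ _ rest (bounded small _) = +-monoʳ-≤ _ (space≤length*T rest (All.map⁻ small))

item∉replicate-empty : ∀ n {v} → item v ∉ replicate n empty
item∉replicate-empty n item∈ with All.lookup (All.replicate⁺ {P = _≡ empty} n refl) item∈
... | ()

step-item-origin : ∀ x m s {m′ v} → step x m s ≡ just m′ → item v ∈ words m′ → item v ∈ words m ⊎ v ≡ x
step-item-origin x m (alloc b len) eq item∈ with isAllocated m b
... | false with refl ← eq with ∈-++⁻ (words m) (subst (_ ∈_) (words-++ m _) item∈)
...   | inj₁ item∈m     = inj₁ item∈m
...   | inj₂ item∈block = ⊥-elim (item∉replicate-empty len (subst (_ ∈_) (++-identityʳ _) item∈block))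
step-item-origin x m (free b) eq item∈ with b ≟ mainId
... | no _ with isAllocated m b
...   | true with refl ← eq = inj₁ (words-mono (removeBlock-⊆ m b) item∈)
step-item-origin x m (copy src dst) eq item∈ with readMem m src in read≡
... | just w with writeMem-∈ m dst eq item∈
...   | inj₁ item∈m = inj₁ item∈m
...   | inj₂ refl   = inj₁ (readMem-∈ m src read≡)
step-item-origin x m (putNew l) eq item∈ with writeMem-∈ m l eq item∈
... | inj₁ item∈m = inj₁ item∈m
... | inj₂ refl   = inj₂ refl
step-item-origin x m (putPtr l b) eq item∈ with writeMem-∈ m l eq item∈
... | inj₁ item∈m = inj₁ item∈m
step-item-origin x m (erase l) eq item∈ with writeMem-∈ m l eq item∈
... | inj₁ item∈m = inj₁ item∈m

step-Stores : ∀ x m s {m′ vs} → step x m s ≡ just m′ → x ∉ vs → Stores m′ vs → Stores m vs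
step-Stores x m s eq x∉vs stores v∈vs with step-item-origin x m s eq (stores v∈vs)
... | inj₁ item∈m = item∈m
... | inj₂ refl   = ⊥-elim (x∉vs v∈vs)

step-Bounded : ∀ {L T} x m s {m′} → step x m s ≡ just m′ → space m′ ≤ space m + T →
               Bounded L T (layout m) → Bounded L T (layout m′)
step-Bounded {T = T} x m (alloc b len) eq grown bd with isAllocated m b in fresh
... | false with refl ← eq =
  subst (Bounded _ T) (sym (map-++ (map₂ length) m _))
    (Bounded-∷ʳ (isAllocated-false⇒¬Allocated m fresh ∘ ∈-ids⇒Allocated m) len≤T bd)
  where
  len≤T : length (replicate len empty) ≤ T
  len≤T = +-cancelˡ-≤ (space m) _ T
            (subst (_≤ space m + T) (trans (space-++ m _) (cong (space m +_) (+-identityʳ _))) grown)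
step-Bounded x m (free b) eq grown bd with b ≟ mainId
... | no b≢main with isAllocated m b
...   | true with refl ← eq = Bounded-removeBlock m b≢main bd
step-Bounded x m (copy src dst) eq grown bd with readMem m src
... | just w = subst (Bounded _ _) (sym (writeMem-layout m dst eq)) bd
step-Bounded x m (putNew l)   eq grown bd = subst (Bounded _ _) (sym (writeMem-layout m l eq)) bd
step-Bounded x m (putPtr l b) eq grown bd = subst (Bounded _ _) (sym (writeMem-layout m l eq)) bd
step-Bounded x m (erase l)    eq grown bd = subst (Bounded _ _) (sym (writeMem-layout m l eq)) bd

data Trace (x : ℕ) : Mem → List Mem → Set where
  []  : ∀ {m} → Trace x m []
  _∷_ : ∀ {m m′ ms} → ∃ (λ s → step x m s ≡ just m′) → Trace x m′ ms → Trace x m (m′ ∷ ms)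

exec⇒Trace : ∀ x m ss {ms} → exec x m ss ≡ just ms → Trace x m ms
exec⇒Trace x m []       refl = []
exec⇒Trace x m (s ∷ ss) eq with step x m s in step≡
... | just m′ with exec x m′ ss in exec≡
...   | just _ with refl ← eq = (s , step≡) ∷ exec⇒Trace x m′ ss exec≡

final-∈ : ∀ m ms → final m ms ∈ m ∷ ms
final-∈ m []        = here refl
final-∈ m (m′ ∷ ms) = there (final-∈ m′ ms)

Trace-Stores : ∀ {x m ms vs} → Trace x m ms → x ∉ vs →
               Stores (final m ms) vs → All (λ m′ → Stores m′ vs) (m ∷ ms)
Trace-Stores [] x∉vs stores = stores ∷ []
Trace-Stores {x} {m} ((s , step≡) ∷ trace) x∉vs stores with Trace-Stores trace x∉vs stores
... | stores′ ∷ later = step-Stores x m s step≡ x∉vs stores′ ∷ stores′ ∷ later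

Trace-Bounded : ∀ {x m ms n L T} → Trace x m ms →
                All (λ m′ → n ≤ space m′) (m ∷ ms) → All (λ m′ → space m′ ≤ n + T) ms →
                Bounded L T (layout m) → Bounded L T (layout (final m ms))
Trace-Bounded []                 _               _               bd = bd
Trace-Bounded {x} {m} {T = T} ((s , step≡) ∷ trace) (n≤space ∷ lows) (space≤ ∷ highs) bd =
  Trace-Bounded trace lows highs (step-Bounded x m s step≡ (≤-trans space≤ (+-monoˡ-≤ T n≤space)) bd)

module _ {I : Impl} (correct : Correct I) where
  open Correct correct

  Reached⇒Stores : ∀ {as m} → Reached I as m → Stores m as
  Reached⇒Stores {as} {m} r v∈as =
    subst (λ u → item u ∈ words m) (sym (lookup-index v∈as)) (readMem-∈ m _ (accessOK r (index v∈as)))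

  items-and-blocks-fit : ∀ {as blk rest L T} → Reached I as (blk ∷ rest) → Unique as →
                         Bounded L T (layout (blk ∷ rest)) → length as + length rest ≤ space (blk ∷ rest)
  items-and-blocks-fit {as} {blk} {rest} r as! (bounded _ (main∉ids ∷ ids!)) = begin
    length as + length rest               ≡⟨ counted ⟨
    length (map item as ++ pointerWords)  ≤⟨ Unique-⊆⇒length≤ contents! contents⊆words ⟩
    length (words (blk ∷ rest))           ≡⟨ space≡length-words (blk ∷ rest) ⟨
    space (blk ∷ rest)                    ∎
    where
    open ≤-Reasoning
    ids = map proj₁ (layout rest)
    pointerWords = map ptr ids

    counted : length (map item as ++ pointerWords) ≡ length as + length rest
    counted = trans (length-++ (map item as))
      (cong₂ _+_ (length-map item as)
        (trans (length-map ptr ids) (trans (length-map proj₁ (layout rest)) (length-map (map₂ length) rest))))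

    items#pointers : Disjoint (map item as) pointerWords
    items#pointers (w∈items , w∈pointers) with ∈-map⁻ item w∈items | ∈-map⁻ ptr w∈pointers
    ... | _ , _ , refl | _ , _ , ()

    contents! : Unique (map item as ++ pointerWords)
    contents! = Unique.++⁺ (Unique.map⁺ item-injective as!) (Unique.map⁺ ptr-injective ids!) items#pointers

    pointed : ∀ {c} → c ∈ ids → ptr c ∈ words (blk ∷ rest)
    pointed c∈ids with pointers r _ (All.lookup main∉ids c∈ids ∘ sym) (there (∈-ids⇒Allocated rest c∈ids))
    ... | blk′ , blk′∈m , ptr∈blk′ = ∈-concat⁺′ ptr∈blk′ (∈-map⁺ proj₂ blk′∈m)

    contents⊆words : map item as ++ pointerWords ⊆ words (blk ∷ rest)
    contents⊆words w∈ with ∈-++⁻ (map item as) w∈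
    ... | inj₁ w∈items with ∈-map⁻ item w∈items
    ...   | _ , a∈as , refl = Reached⇒Stores r a∈as
    contents⊆words w∈ | inj₂ w∈pointers with ∈-map⁻ ptr w∈pointers
    ...   | _ , c∈ids , refl = pointed c∈ids

  blocks-fit : ∀ {as m L T} → Reached I as m → Unique as → Bounded L T (layout m) →
               ∃ λ k → length as + k ≤ space m × space m ≤ L + k * T
  blocks-fit {m = blk ∷ rest} r as! bd = length rest , items-and-blocks-fit r as! bd , Bounded⇒space≤ blk rest bd

  reachable-upTo : ∀ n → ∃ (Reached I (upTo n))
  reachable-upTo zero = _ , init
  reachable-upTo (suc n) with m , r ← reachable-upTo n with ms , exec≡ ← growValid r n =
    final m ms , subst (λ as → Reached I as (final m ms)) (upTo-∷ʳ n) (grow r exec≡)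

  module _ {s t : ℕ → ℕ} (isST : IsST s t I) where
    open IsST isST

    mainLen≤s0 : mainLen I ≤ s 0
    mainLen≤s0 = subst (_≤ s 0) (trans (+-identityʳ _) (length-replicate (mainLen I))) (storeBound init)

    new-item-needs-room : ∀ {as m x} → Reached I as m → Unique (as ∷ʳ x) → 1 ≤ t (length as)
    new-item-needs-room {as} {m} {x} r asx! with ms , exec≡ ← growValid r x =
      +-cancelˡ-≤ (length as) 1 (t (length as)) (begin
        length as + 1       ≡⟨ length-++ as ⟨
        length (as ∷ʳ x)    ≤⟨ items-fit {final m ms} asx! (Reached⇒Stores (grow r exec≡)) ⟩
        space (final m ms)  ≤⟨ All.lookup (growBound r x ms exec≡) (final-∈ m ms) ⟩
        length as + t (length as) ∎)
      where open ≤-Reasoning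

    blocks-bounded : NonDecreasing t → ∀ {N as m} → Reached I as m → Unique as → length as ≤ N →
                     Bounded (mainLen I) (t N) (layout m)
    blocks-bounded _ init _ _ = Bounded-init (mainLen I) _
    blocks-bounded t-mono {N} (grow {as} {m} {x} {ms} r exec≡) asx! |asx|≤N =
      Trace-Bounded trace lows highs (blocks-bounded t-mono r as! |as|≤N)
      where
      trace = exec⇒Trace x m (growSteps I as x m) exec≡
      as! = proj₁ (Unique-∷ʳ⁻ as asx!)
      x∉as = proj₂ (Unique-∷ʳ⁻ as asx!)

      |as|≤N : length as ≤ N
      |as|≤N = ≤-trans (m≤m+n (length as) 1) (subst (_≤ N) (length-++ as) |asx|≤N)

      lows : All (λ m′ → length as ≤ space m′) (m ∷ ms)
      lows = All.map (λ {m′} → items-fit {m′} as!)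
               (Trace-Stores trace x∉as (Reached⇒Stores (grow r exec≡) ∘ ∈-++⁺ˡ))

      highs : All (λ m′ → space m′ ≤ length as + t N) ms
      highs = All.map (λ bound → ≤-trans bound (+-monoʳ-≤ (length as) (t-mono |as|≤N)))
                (All.tail (growBound r x ms exec≡))

theorem4p2 : (s t : ℕ → ℕ) → NonDecreasing s → NonDecreasing t →
             (I : Impl) → Correct I → IsST s t I →
             ∀ N → N ≤ s N * t N
theorem4p2 s t s-mono t-mono I correct isST N
  with m , r ← reachable-upTo correct N
  with k , lower , upper ← blocks-fit correct r (Unique.upTo⁺ N)
                             (blocks-bounded correct isST t-mono r (Unique.upTo⁺ N) (≤-reflexive (length-upTo N)))
  = n+k≤s+k*t⇒n≤s*t (≤-trans N+k≤space (≤-trans upper (+-monoˡ-≤ (k * t N) L≤sN))) k≤sN 1≤tN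
  where
  open IsST isST
  N+k≤space : N + k ≤ space m
  N+k≤space = subst (λ n → n + k ≤ space m) (length-upTo N) lower

  k≤sN : k ≤ s N
  k≤sN = +-cancelˡ-≤ N k (s N)
           (≤-trans N+k≤space (subst (λ n → space m ≤ n + s n) (length-upTo N) (storeBound r)))

  L≤sN : mainLen I ≤ s N
  L≤sN = ≤-trans (mainLen≤s0 correct isST) (s-mono z≤n)

  1≤tN : 1 ≤ t N
  1≤tN = subst (λ n → 1 ≤ t n) (length-upTo N)
           (new-item-needs-room correct isST r (subst Unique (sym (upTo-∷ʳ N)) (Unique.upTo⁺ (suc N))))
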